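{- Let $m\ge1$ and let $\epsilon=(\epsilon_1,\dots,\epsilon_s)$ be a circular sequence with $\epsilon_i\in\{1,-1\}$ for all $i$. No free linear digraph of $\Gamma^m_\epsilon$ consists of a single vertex.
   Context: Indices are mod $s$. Digraph $\Gamma^m_\epsilon$: vertices $x_{i,t}$, $0\le i\le m-1$, $t\in\{1,\dots,s\}$, some "marked zero". If $s=1$: all vertices are marked zero, no edges. If $s\ge2$: for each $t$ let $A_t=\max(\epsilon_t,0)$, $B_t=\max(-\epsilon_{t+1},0)$; for each $j\in\{0,\dots,m-1\}$: if $j\ge\max(A_t,B_t)$ add an edge from $x_{j-A_t,t}$ to $x_{j-B_t,t+1}$ of weight $A_t-B_t$; if $A_t\le j<B_t$ mark $x_{j-A_t,t}$ zero; if $B_t\le j<A_t$ mark $x_{j-B_t,t+1}$ zero. Each connected component is a directed path (linear digraph, possibly a single vertex) or a directed cycle; a linear digraph with no vertex marked zero is a free linear digraph. -}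

module Defs where

open import Data.Nat using (ℕ; zero; suc; _∸_; _≤_; _<_)
open import Data.Nat.DivMod using (_mod_)
open import Data.Fin using (Fin; toℕ)
open import Data.Integer as ℤ using (ℤ; ∣_∣; _⊔_; -_; 0ℤ)
open import Data.Product using (Σ; _×_; _,_; proj₁)
open import Data.Sum using (_⊎_)
open import Relation.Binary.PropositionalEquality using (_≡_)
open import Relation.Nullary using (¬_)

-- Circular sequences of length s = suc n, indexed by Fin (suc n)
-- (paper's t ∈ {1,…,s} corresponds to t-1 here); indices mod s.
next : ∀ {n} → Fin (suc n) → Fin (suc n)
next {n} t = suc (toℕ t) mod (suc n)

-- A vertex x_{i,t} is the pair (i , t); valid vertices have i < m.
Vertex : ℕ → Set
Vertex n = ℕ × Fin (suc n)

module _ (m n : ℕ) (ε : Fin (suc n) → ℤ) where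

  A : Fin (suc n) → ℕ
  A t = ∣ ε t ⊔ 0ℤ ∣

  B : Fin (suc n) → ℕ
  B t = ∣ (- ε (next t)) ⊔ 0ℤ ∣

  -- Edge relation of Γ^m_ε (weights A_t - B_t are irrelevant here).
  Edge : Vertex n → Vertex n → Set
  Edge v w = 2 ≤ suc n × Σ (Fin (suc n)) λ t → Σ ℕ λ j →
    j < m × A t ≤ j × B t ≤ j ×
    v ≡ (j ∸ A t , t) × w ≡ (j ∸ B t , next t)

  MarkedZero : Vertex n → Set
  MarkedZero v = (suc n ≡ 1) ⊎
    (2 ≤ suc n × Σ (Fin (suc n)) λ t → Σ ℕ λ j → j < m ×
      ((A t ≤ j × j < B t × v ≡ (j ∸ A t , t))
       ⊎ (B t ≤ j × j < A t × v ≡ (j ∸ B t , next t))))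

  -- The connected component of v is the single vertex v: no edge is incident to v.
  SingleVertexComponent : Vertex n → Set
  SingleVertexComponent v = (∀ w → ¬ Edge v w) × (∀ w → ¬ Edge w v)

  -- A free linear digraph consisting of the single vertex v
  -- (a single vertex is a linear digraph; free = not marked zero).
  FreeSingleVertex : Vertex n → Set
  FreeSingleVertex v = proj₁ v < m × SingleVertexComponent v × ¬ MarkedZero v

module Submission where

-- Let v = x_{i,t} be a vertex with i < m.  If s = 1 every vertex
-- is marked zero.  If s ≥ 2, look at the index j = i in the definition of
-- Γ^m_ε:
--   * if A_t = 0, then either B_t ≤ i and the edge x_{i,t} → x_{i-B_t,t+1}
--     leaves v, or i < B_t and v is marked zero;
--   * if B_{t-1} = 0, then either A_{t-1} ≤ i and the edge
--     x_{i-A_{t-1},t-1} → x_{i,t} enters v, or i < A_{t-1} and v is marked zero.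
-- Since ε_t ≤ 0 forces A_t = 0 and ε_t ≥ 0 forces B_{t-1} = 0, one of the two
-- cases always applies.  So no vertex is a free single-vertex component, for
-- every integer sequence ε; the corollary (ε_t = ±1, m ≥ 1) is a special case.

open import Defs
open import Data.Nat using (ℕ; zero; suc; _≤_; _<_; _∸_; z≤n; s≤s; _%_)
open import Data.Nat.Properties using (_≤?_; ≰⇒>)
open import Data.Nat.DivMod using (n%n≡0; m<n⇒m%n≡m)
open import Data.Fin using (Fin; toℕ; fromℕ; inject₁) renaming (zero to fzero; suc to fsuc)
open import Data.Fin.Properties using (toℕ-injective; toℕ-fromℕ<; toℕ-fromℕ; toℕ-inject₁; toℕ<n)
open import Data.Integer as ℤ using (ℤ; -_; 1ℤ; 0ℤ)
open import Data.Integer.Properties as ℤ using (i≤j⇒i⊔j≡j; neg-mono-≤)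
open import Data.Sum using (_⊎_; inj₁; inj₂)
open import Data.Product using (∃; _,_)
open import Relation.Binary.PropositionalEquality using (_≡_; refl; sym; trans; cong; subst)
open import Relation.Nullary using (¬_; Dec; yes; no)

predecessor : ∀ {n} (t : Fin (suc n)) → ∃ λ t′ → next t′ ≡ t
predecessor {n} fzero = fromℕ n , toℕ-injective (trans (toℕ-fromℕ< _)
  (trans (cong (λ k → suc k % suc n) (toℕ-fromℕ n)) (n%n≡0 (suc n))))
predecessor {suc n} (fsuc k) = inject₁ k , toℕ-injective (trans (toℕ-fromℕ< _)
  (trans (cong (λ k′ → suc k′ % suc (suc n)) (toℕ-inject₁ k)) (m<n⇒m%n≡m (s≤s (toℕ<n k)))))

module _ (m n : ℕ) (ε : Fin (suc n) → ℤ) where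

  A-vanishes : ∀ t → ε t ℤ.≤ 0ℤ → A m n ε t ≡ 0
  A-vanishes t ε≤0 = cong ℤ.∣_∣ (i≤j⇒i⊔j≡j ε≤0)

  B-vanishes : ∀ t → 0ℤ ℤ.≤ ε (next t) → B m n ε t ≡ 0
  B-vanishes t 0≤ε = cong ℤ.∣_∣ (i≤j⇒i⊔j≡j (neg-mono-≤ 0≤ε))

  Covered : Vertex n → Set
  Covered v = (∃ λ w → Edge m n ε v w) ⊎ (∃ λ w → Edge m n ε w v) ⊎ MarkedZero m n ε v

  covered⇒¬free : ∀ v → Covered v → ¬ FreeSingleVertex m n ε v
  covered⇒¬free v (inj₁ (w , out))         (_ , (no-out , _) , _) = no-out w out
  covered⇒¬free v (inj₂ (inj₁ (w , into))) (_ , (_ , no-in) , _)  = no-in w into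
  covered⇒¬free v (inj₂ (inj₂ marked))     (_ , _ , unmarked)     = unmarked marked

  -- If A_t = 0, the index j = i makes x_{i,t} the tail of an edge or marks it zero.
  covered-as-tail : 2 ≤ suc n → ∀ {i} t → A m n ε t ≡ 0 → i < m → Covered (i , t)
  covered-as-tail two≤s {i} t A≡0 i<m = by-cases (B m n ε t ≤? i)
    where
    A≤i : A m n ε t ≤ i
    A≤i = subst (_≤ i) (sym A≡0) z≤n
    v≡ : (i , t) ≡ (i ∸ A m n ε t , t)
    v≡ = cong (λ a → i ∸ a , t) (sym A≡0)
    by-cases : Dec (B m n ε t ≤ i) → Covered (i , t)
    by-cases (yes B≤i) = inj₁ (_ , two≤s , t , i , i<m , A≤i , B≤i , v≡ , refl)
    by-cases (no B≰i)  = inj₂ (inj₂ (inj₂ (two≤s , t , i , i<m , inj₁ (A≤i , ≰⇒> B≰i , v≡))))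

  -- If B_t = 0, the index j = i makes x_{i,t+1} the head of an edge or marks it zero.
  covered-as-head : 2 ≤ suc n → ∀ {i} t → B m n ε t ≡ 0 → i < m → Covered (i , next t)
  covered-as-head two≤s {i} t B≡0 i<m = by-cases (A m n ε t ≤? i)
    where
    B≤i : B m n ε t ≤ i
    B≤i = subst (_≤ i) (sym B≡0) z≤n
    v≡ : (i , next t) ≡ (i ∸ B m n ε t , next t)
    v≡ = cong (λ b → i ∸ b , next t) (sym B≡0)
    by-cases : Dec (A m n ε t ≤ i) → Covered (i , next t)
    by-cases (yes A≤i) = inj₂ (inj₁ (_ , two≤s , t , i , i<m , A≤i , B≤i , refl , v≡))
    by-cases (no A≰i)  = inj₂ (inj₂ (inj₂ (two≤s , t , i , i<m , inj₂ (B≤i , ≰⇒> A≰i , v≡))))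

  -- Every vertex x_{i,t} with i < m is covered when s ≥ 2: by the tail lemma
  -- if ε_t ≤ 0, and by the head lemma at t - 1 if ε_t ≥ 0.
  every-vertex-covered : 2 ≤ suc n → ∀ i t → i < m → Covered (i , t)
  every-vertex-covered two≤s i t i<m with ℤ.≤-total (ε t) 0ℤ | predecessor t
  ... | inj₁ ε≤0 | _        = covered-as-tail two≤s t (A-vanishes t ε≤0) i<m
  ... | inj₂ 0≤ε | t′ , t′+1≡t =
    subst (λ u → Covered (i , u)) t′+1≡t
      (covered-as-head two≤s t′ (B-vanishes t′ (subst (λ u → 0ℤ ℤ.≤ ε u) (sym t′+1≡t) 0≤ε)) i<m)

no-free-single-vertex : (m n : ℕ) (ε : Fin (suc n) → ℤ) (v : Vertex n) → ¬ FreeSingleVertex m n ε v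
no-free-single-vertex m zero    ε v       (_ , _ , unmarked) = unmarked (inj₁ refl)
no-free-single-vertex m (suc k) ε (i , t) free@(i<m , _) =
  covered⇒¬free m (suc k) ε (i , t) (every-vertex-covered m (suc k) ε (s≤s (s≤s z≤n)) i t i<m) free

corollary4p2 : (m : ℕ) → 1 ≤ m → (n : ℕ) → (ε : Fin (suc n) → ℤ) →
    (∀ t → ε t ≡ 1ℤ ⊎ ε t ≡ - 1ℤ) →
    (v : Vertex n) → ¬ FreeSingleVertex m n ε v
corollary4p2 m _ n ε _ = no-free-single-vertex m n ε
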